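{- Let $T_0$ be a theory and let $T$ be the smallest closed theory including $T_0$. If $T_0$ is generic, then $T$ is generic; and if $T_0$ is closed generic, then $T$ is closed generic.
   Context: Fix a nonempty set of symbols called propositional atoms and a symbol $\mathrm{K}$ which is not a propositional atom. Formulas are defined recursively: every propositional atom is a formula; if $\varphi,\psi$ are formulas then so are $\neg\varphi$, $(\varphi\wedge\psi)$, $(\varphi\vee\psi)$, $(\varphi\rightarrow\psi)$; if $\varphi$ is a formula then so is $\mathrm{K}(\varphi)$. A formula is basic if it is a propositional atom or of the form $\mathrm{K}\varphi$. A theory is a set of formulas. A model is a function assigning a truth value to every basic formula; truth $\mathscr M\models\varphi$ of an arbitrary formula is defined from the values of basic formulas by the classical truth tables (formulas $\mathrm{K}\varphi$ are treated like atoms). $\mathscr M\models T$ means $\mathscr M\models\varphi$ for all $\varphi\in T$; $T\models\varphi$ means every model of $T$ satisfies $\varphi$. A theory $T$ is closed if $\varphi\in T$ implies $\mathrm{K}\varphi\in T$. For a theory $T$ and a set $S$ of propositional atoms, $\mathscr M_{T,S}$ is the model with $\mathscr M_{T,S}\models p$ iff $p\in S$ for atoms $p$, and $\mathscr M_{T,S}\models\mathrm{K}\varphi$ iff $T\models\varphi$. A theory $T$ is generic if for every set $S$ of propositional atoms and every theory $T'\supseteq T$, $\mathscr M_{T',S}\models T$; $T$ is closed generic if for every set $S$ of propositional atoms and every closed theory $T'\supseteq T$, $\mathscr M_{T',S}\models T$. -}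

module Defs where

open import Data.Bool using (Bool; true; false; not; _∧_; _∨_)
open import Data.Product using (_×_)
open import Relation.Binary.PropositionalEquality using (_≡_)
open import Function.Bundles using (_⇔_)

data Formula (A : Set) : Set where
  atom : A → Formula A
  ¬′_  : Formula A → Formula A
  _∧′_ : Formula A → Formula A → Formula A
  _∨′_ : Formula A → Formula A → Formula A
  _⇒′_ : Formula A → Formula A → Formula A
  K    : Formula A → Formula A

Theory : Set → Set₁
Theory A = Formula A → Set

-- A model assigns a truth value to every basic formula:
-- to every atom p and to every formula of the form K φ.
record Model (A : Set) : Set where
  field
    valAtom : A → Bool
    valK    : Formula A → Bool
open Model public

eval : {A : Set} → Model A → Formula A → Bool
eval M (atom p) = valAtom M p
eval M (¬′ φ) = not (eval M φ)
eval M (φ ∧′ ψ) = eval M φ ∧ eval M ψ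
eval M (φ ∨′ ψ) = eval M φ ∨ eval M ψ
eval M (φ ⇒′ ψ) = not (eval M φ) ∨ eval M ψ
eval M (K φ) = valK M φ

_⊨_ : {A : Set} → Model A → Formula A → Set
M ⊨ φ = eval M φ ≡ true

_⊨ᵀ_ : {A : Set} → Model A → Theory A → Set
M ⊨ᵀ T = ∀ φ → T φ → M ⊨ φ

_⊩_ : {A : Set} → Theory A → Formula A → Set
_⊩_ {A} T φ = ∀ (M : Model A) → M ⊨ᵀ T → M ⊨ φ

_⊆_ : {A : Set} → Theory A → Theory A → Set
T ⊆ T′ = ∀ φ → T φ → T′ φ

Closed : {A : Set} → Theory A → Set
Closed T = ∀ φ → T φ → T (K φ)

-- M is the model M_{T,S}: atoms true exactly on S, K φ true exactly when T ⊨ φ.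
-- (Stated as a characterisation, since T ⊨ φ is not decidable constructively;
--  such a model is unique.)
IsM : {A : Set} → Theory A → (A → Set) → Model A → Set
IsM T S M = (∀ p → (valAtom M p ≡ true) ⇔ S p)
          × (∀ φ → (valK M φ ≡ true) ⇔ (T ⊩ φ))

Generic : {A : Set} → Theory A → Set₁
Generic {A} T = ∀ (S : A → Set) (T′ : Theory A) → T ⊆ T′ →
  ∀ (M : Model A) → IsM T′ S M → M ⊨ᵀ T

ClosedGeneric : {A : Set} → Theory A → Set₁
ClosedGeneric {A} T = ∀ (S : A → Set) (T′ : Theory A) → T ⊆ T′ → Closed T′ →
  ∀ (M : Model A) → IsM T′ S M → M ⊨ᵀ T

SmallestClosedOver : {A : Set} → Theory A → Theory A → Set₁
SmallestClosedOver {A} T₀ T =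
  Closed T × T₀ ⊆ T × (∀ (U : Theory A) → Closed U → T₀ ⊆ U → T ⊆ U)

{-# OPTIONS --safe #-}
module Submission where

open import Defs
open import Data.Product using (_×_; _,_; proj₁; proj₂)
open import Function.Bundles using (Equivalence)

-- T together with the formulas true in a model M_{T′,S}, T ⊆ T′, is closed:
-- every φ ∈ T ⊆ T′ is a consequence of T′, so M_{T′,S} ⊨ K φ.  Minimality of
-- the closure of T₀ then forces every formula of T to be true in M_{T′,S}.

⊆-trans : {A : Set} {T U V : Theory A} → T ⊆ U → U ⊆ V → T ⊆ V
⊆-trans T⊆U U⊆V φ Tφ = U⊆V φ (T⊆U φ Tφ)

member⇒⊩ : {A : Set} {T : Theory A} {φ : Formula A} → T φ → T ⊩ φ
member⇒⊩ {φ = φ} Tφ M M⊨T = M⊨T φ Tφ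

IsM⇒⊨K : {A : Set} {T : Theory A} {S : A → Set} {M : Model A} {φ : Formula A} →
  IsM T S M → T φ → M ⊨ K φ
IsM⇒⊨K {φ = φ} (_ , valK⇔⊩) Tφ = Equivalence.from (valK⇔⊩ φ) (member⇒⊩ Tφ)

_∩ᵀ_ : {A : Set} → Theory A → Model A → Theory A
(T ∩ᵀ M) φ = T φ × M ⊨ φ

∩ᵀ-closed : {A : Set} {T T′ : Theory A} {S : A → Set} {M : Model A} →
  Closed T → T ⊆ T′ → IsM T′ S M → Closed (T ∩ᵀ M)
∩ᵀ-closed closedT T⊆T′ isM φ (Tφ , _) = closedT φ Tφ , IsM⇒⊨K isM (T⊆T′ φ Tφ)

closure-true-in-IsM : {A : Set} {T₀ T T′ : Theory A} {S : A → Set} {M : Model A} →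
  SmallestClosedOver T₀ T → T ⊆ T′ → IsM T′ S M → M ⊨ᵀ T₀ → M ⊨ᵀ T
closure-true-in-IsM {T₀ = T₀} {T} {M = M} (closedT , T₀⊆T , least) T⊆T′ isM M⊨T₀ φ Tφ =
  proj₂ (least (T ∩ᵀ M) (∩ᵀ-closed closedT T⊆T′ isM) T₀⊆T∩M φ Tφ)
  where
  T₀⊆T∩M : T₀ ⊆ (T ∩ᵀ M)
  T₀⊆T∩M ψ T₀ψ = T₀⊆T ψ T₀ψ , M⊨T₀ ψ T₀ψ

lemma16 : (A : Set) → A → (T₀ T : Theory A) → SmallestClosedOver T₀ T →
    (Generic T₀ → Generic T) × (ClosedGeneric T₀ → ClosedGeneric T)
lemma16 A _ T₀ T closure@(_ , T₀⊆T , _) = generic , closedGeneric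
  where
  generic : Generic T₀ → Generic T
  generic gen₀ S T′ T⊆T′ M isM =
    closure-true-in-IsM closure T⊆T′ isM (gen₀ S T′ (⊆-trans T₀⊆T T⊆T′) M isM)

  closedGeneric : ClosedGeneric T₀ → ClosedGeneric T
  closedGeneric gen₀ S T′ T⊆T′ closedT′ M isM =
    closure-true-in-IsM closure T⊆T′ isM
      (gen₀ S T′ (⊆-trans T₀⊆T T⊆T′) closedT′ M isM)
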